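{- Let $G=(V,E)$ be a finite simple undirected graph, $s\in V$ and $W\subseteq V$. Then the number of orientations of $G$ in which every $w\in W$ is reachable from $s$ by a directed path equals the number of subsets $X\subseteq E$ such that all vertices of $W\cup\{s\}$ lie in a single connected component of $(V,X)$.
   Context: An orientation of $G$ assigns a direction to each edge. -}

module Defs where

open import Data.Nat using (ℕ)
open import Data.Fin using (Fin; _<_)
open import Data.Fin.Subset using (Subset; _∈_)
open import Data.Bool using (Bool; true; false)
open import Data.List using (List; length)
open import Data.Vec using (Vec; lookup; fromList)
open import Data.Product using (Σ; ∃; _×_; _,_)
open import Data.Sum using (_⊎_)
open import Data.List.Relation.Unary.All using (All)
open import Data.List.Relation.Unary.Unique.Propositional using (Unique)
import Data.List.Membership.Propositional as LM
open import Relation.Binary.PropositionalEquality using (_≡_)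
open import Relation.Binary.Construct.Closure.ReflexiveTransitive using (Star)
open import Function.Bundles using (_⇔_)

-- Each edge {u,v} is stored once, as the pair (u , v) with u < v (so no loops),
-- and the list has no duplicates (so no multi-edges).
record SimpleGraph (n : ℕ) : Set where
  field
    edges   : List (Fin n × Fin n)
    ordered : All (λ e → Data.Product.proj₁ e < Data.Product.proj₂ e) edges
    unique  : Unique edges

open SimpleGraph public

#E : ∀ {n} → SimpleGraph n → ℕ
#E G = length (edges G)

edge : ∀ {n} (G : SimpleGraph n) → Fin (#E G) → Fin n × Fin n
edge G i = lookup (fromList (edges G)) i

-- An orientation assigns a direction to each edge: for the edge (u , v),
-- true means u → v and false means v → u.
Orientation : ∀ {n} → SimpleGraph n → Set
Orientation G = Vec Bool (#E G)

Arc : ∀ {n} (G : SimpleGraph n) → Orientation G → Fin n → Fin n → Set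
Arc G o a b = ∃ λ i →
  (edge G i ≡ (a , b) × lookup o i ≡ true) ⊎ (edge G i ≡ (b , a) × lookup o i ≡ false)

Reachable : ∀ {n} (G : SimpleGraph n) → Orientation G → Fin n → Fin n → Set
Reachable G o = Star (Arc G o)

-- A subset X ⊆ E, as a characteristic vector over the edges.
EdgeSubset : ∀ {n} → SimpleGraph n → Set
EdgeSubset G = Vec Bool (#E G)

Adj : ∀ {n} (G : SimpleGraph n) → EdgeSubset G → Fin n → Fin n → Set
Adj G X a b = ∃ λ i → lookup X i ≡ true × (edge G i ≡ (a , b) ⊎ edge G i ≡ (b , a))

Connected : ∀ {n} (G : SimpleGraph n) → EdgeSubset G → Fin n → Fin n → Set
Connected G X = Star (Adj G X)

-- P has exactly k solutions in A: there is a duplicate-free list of length k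
-- whose members are exactly the elements satisfying P.
HasCount : {A : Set} → (A → Set) → ℕ → Set
HasCount {A} P k = Σ (List A) λ xs →
  length xs ≡ k × Unique xs × (∀ x → (x LM.∈ xs) ⇔ P x)

AllReachable : ∀ {n} (G : SimpleGraph n) → Fin n → Subset n → Orientation G → Set
AllReachable {n} G s W o = ∀ (w : Fin n) → w ∈ W → Reachable G o s w

-- all vertices of W ∪ {s} lie in a single connected component of (V , X)
-- (equivalently, since connectivity is an equivalence relation: each w ∈ W is
-- in the component of s)
SameComponent : ∀ {n} (G : SimpleGraph n) → Fin n → Subset n → EdgeSubset G → Set
SameComponent {n} G s W X = ∀ (w : Fin n) → w ∈ W → Connected G X s w

module Submission where

-- The count identity is proved by an explicit bijection, built from a
-- search started at s.  The search keeps an explored vertex set S (initially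
-- {s}) and repeatedly takes an unprocessed edge with an endpoint in S.  The
-- edge is entered from an explored endpoint; we record whether it is entered
-- against its stored direction (the 'reversal' bit), and whether it may be
-- crossed is decided by a 'permission'.  An orientation permits crossing an
-- edge exactly in its direction, an edge set permits crossing its members in
-- both directions and nothing else; in either case the search explores exactly the vertices
-- reachable from s (Search.reach).
--
-- Crucially, a run only consults the permission of each processed edge at
-- its recorded reversal bit (Search.explore-agree).  Xor-ing an orientation
-- with the reversal bits of its run therefore gives an edge set whose run is
-- identical, and vice versa; this 'transfer' is an involution between
-- orientations and edge sets that preserves the explored set (run-transfer,
-- transfer-involutive).  Since an orientation reaches W from s iff W lies in
-- its explored set, and likewise for connectivity, the transfer carries one
-- kind of object onto the other, and the generic counting lemmas for
-- enumerated types finish the proof.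

open import Defs
open import Data.Nat using (ℕ; zero; suc; _≤_)
open import Data.Nat.Properties using (≤-reflexive; ≤-trans; ≤-pred)
open import Data.Bool using (Bool; true; false; not; _xor_)
open import Data.Bool.Properties using (not-involutive; not-injective)
open import Data.Fin using (Fin; _≟_)
open import Data.Fin.Subset using (Subset; _∈_; _⊆_; _∪_; ⁅_⁆)
open import Data.Fin.Subset.Properties using (_∈?_; _⊆?_; x∈⁅x⁆; x∈⁅y⁆⇒x≡y; p⊆p∪q; q⊆p∪q; x∈p∪q⁻)
open import Data.List using (List; []; _∷_; [_]; length; filter; map; allFin; cartesianProductWith)
open import Data.List.Properties using (length-map; length-tabulate; filter-notAll)
open import Data.List.Membership.Propositional using (find; lose) renaming (_∈_ to _∈ₗ_)
open import Data.List.Membership.Propositional.Properties using (∈-filter⁺; ∈-filter⁻; ∈-map⁺; ∈-map⁻; ∈-allFin; ∈-cartesianProductWith⁺)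
open import Data.List.Relation.Unary.Any using (here; there; any?)
import Data.List.Relation.Unary.Any as Any
import Data.List.Relation.Unary.All as All
import Data.List.Relation.Unary.AllPairs as AllPairs
open import Data.List.Relation.Unary.Unique.Propositional using (Unique)
import Data.List.Relation.Unary.Unique.Propositional.Properties as Unique
open import Data.Vec using (Vec; []; _∷_; lookup; replicate; zipWith; _[_]≔_)
open import Data.Vec.Properties using (∷-injective; lookup∘update; lookup∘update′; lookup-zipWith)
open import Data.Product using (Σ; ∃; _×_; _,_; proj₁; proj₂)
open import Data.Sum using (_⊎_; inj₁; inj₂)
import Data.Sum as Sum
open import Data.Empty using (⊥-elim)
open import Relation.Nullary using (Dec; yes; no; ¬_; ¬?)
open import Relation.Nullary.Decidable using (_⊎-dec_)
import Relation.Nullary.Decidable as Dec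
open import Relation.Unary using (Pred; Decidable)
open import Relation.Binary.PropositionalEquality using (_≡_; refl; sym; trans; cong; cong₂; subst; module ≡-Reasoning)
open import Relation.Binary.Construct.Closure.ReflexiveTransitive using (Star; ε; _◅_)
import Relation.Binary.Construct.Closure.ReflexiveTransitive as Star
open import Function using (_∘_)
open import Function.Bundles using (_⇔_; mk⇔; Equivalence)
import Function.Properties.Equivalence as ⇔


record Enumeration (A : Set) : Set where
  field
    elements : List A
    distinct : Unique elements
    complete : ∀ x → x ∈ₗ elements

open Enumeration

booleans : Enumeration Bool
booleans = record
  { elements = true ∷ false ∷ []
  ; distinct = ((λ ()) All.∷ All.[]) AllPairs.∷ (All.[] AllPairs.∷ AllPairs.[])
  ; complete = λ { true → here refl ; false → there (here refl) }
  }

vectors : ∀ {A} → Enumeration A → ∀ m → Enumeration (Vec A m)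
vectors E zero = record
  { elements = [ [] ] ; distinct = All.[] AllPairs.∷ AllPairs.[] ; complete = λ { [] → here refl } }
vectors {A} E (suc m) = record
  { elements = cartesianProductWith _∷_ (elements E) (elements Eₘ)
  ; distinct = Unique.cartesianProductWith⁺ _∷_ ∷-injective (distinct E) (distinct Eₘ)
  ; complete = λ { (x ∷ xs) → ∈-cartesianProductWith⁺ _∷_ (complete E x) (complete Eₘ xs) }
  }
  where
  Eₘ : Enumeration (Vec A m)
  Eₘ = vectors E m

count : ∀ {A} {P : Pred A _} → (E : Enumeration A) (P? : Decidable P) →
        HasCount P (length (filter P? (elements E)))
count E P? = filter P? (elements E) , refl , Unique.filter⁺ P? (distinct E) ,
             λ x → mk⇔ (proj₂ ∘ ∈-filter⁻ P? {xs = elements E}) (∈-filter⁺ P? (complete E x))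

count-transfer : ∀ {A B} {P : Pred A _} {Q : Pred B _} {k} (f : A → B) (g : B → A) →
                 (∀ x → g (f x) ≡ x) → (∀ y → f (g y) ≡ y) → (∀ x → P x ⇔ Q (f x)) →
                 HasCount P k → HasCount Q k
count-transfer {Q = Q} f g gf fg P⇔Q (xs , len , xs-distinct , xs-mem) =
  map f xs , trans (length-map f xs) len , Unique.map⁺ f-injective xs-distinct , λ y → mk⇔ (to y) (from y)
  where
  f-injective : ∀ {x x'} → f x ≡ f x' → x ≡ x'
  f-injective {x} {x'} e = trans (sym (gf x)) (trans (cong g e) (gf x'))
  to : ∀ y → y ∈ₗ map f xs → Q y
  to y y∈ with ∈-map⁻ f y∈
  ... | x , x∈xs , refl = Equivalence.to (P⇔Q x) (Equivalence.to (xs-mem x) x∈xs)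
  from : ∀ y → Q y → y ∈ₗ map f xs
  from y Qy = subst (_∈ₗ map f xs) (fg y)
    (∈-map⁺ f (Equivalence.from (xs-mem (g y)) (Equivalence.from (P⇔Q (g y)) (subst Q (sym (fg y)) Qy))))

star⇔ : ∀ {A : Set} {R T : A → A → Set} → (∀ {x y} → R x y ⇔ T x y) → ∀ {x y} → Star R x y ⇔ Star T x y
star⇔ R⇔T = mk⇔ (Star.map (Equivalence.to R⇔T)) (Star.map (Equivalence.from R⇔T))

covers⇔ : ∀ {n} {W T : Subset n} {R : Fin n → Set} → (∀ w → R w ⇔ w ∈ T) → (∀ w → w ∈ W → R w) ⇔ W ⊆ T
covers⇔ R⇔T = mk⇔ (λ all {w} w∈W → Equivalence.to (R⇔T w) (all w w∈W)) (λ W⊆T w w∈W → Equivalence.from (R⇔T w) (W⊆T w∈W))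

xor-cancel : ∀ x y → x xor (x xor y) ≡ y
xor-cancel true y = not-involutive y
xor-cancel false y = refl

toggle-twice : ∀ {m} (ρ b : Vec Bool m) → zipWith _xor_ ρ (zipWith _xor_ ρ b) ≡ b
toggle-twice [] [] = refl
toggle-twice (x ∷ ρ) (y ∷ b) = cong₂ _∷_ (xor-cancel x y) (toggle-twice ρ b)

-- An edge e = (u , v) is crossed forwards (u to v,
-- reversal bit false) or backwards (v to u, reversal bit true); a permission
-- a : Bool → Bool says which crossings are allowed.
module _ {n : ℕ} where

  Carries : Fin n × Fin n → (Bool → Bool) → Fin n → Fin n → Set
  Carries e a x y = (e ≡ (x , y) × a false ≡ true) ⊎ (e ≡ (y , x) × a true ≡ true)

  Touches : Subset n → Fin n × Fin n → Set
  Touches S (u , v) = u ∈ S ⊎ v ∈ S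

  touches? : ∀ S e → Dec (Touches S e)
  touches? S (u , v) = (u ∈? S) ⊎-dec (v ∈? S)

  carries-touches : ∀ {S x y} e a → x ∈ S → Carries e a x y → Touches S e
  carries-touches (u , v) a x∈S (inj₁ (refl , _)) = inj₁ x∈S
  carries-touches (u , v) a x∈S (inj₂ (refl , _)) = inj₂ x∈S

  reversal : Subset n → Fin n × Fin n → Bool
  reversal S (u , v) with u ∈? S
  ... | yes _ = false
  ... | no _ = true

  target : Bool → Fin n × Fin n → Fin n
  target false (u , v) = v
  target true (u , v) = u

  extend : Bool → Fin n → Subset n → Subset n
  extend true v S = S ∪ ⁅ v ⁆
  extend false v S = S

  extend-⊇ : ∀ b v {S} → S ⊆ extend b v S
  extend-⊇ true v = p⊆p∪q ⁅ v ⁆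
  extend-⊇ false v x∈S = x∈S

  extend-hit : ∀ {b} v S → b ≡ true → v ∈ extend b v S
  extend-hit v S refl = q⊆p∪q S ⁅ v ⁆ (x∈⁅x⁆ v)

  extend-inv : ∀ b v S {y} → y ∈ extend b v S → y ∈ S ⊎ (b ≡ true × y ≡ v)
  extend-inv true v S y∈ = Sum.map₂ (λ y∈v → refl , x∈⁅y⁆⇒x≡y v y∈v) (x∈p∪q⁻ S ⁅ v ⁆ y∈)
  extend-inv false v S y∈ = inj₁ y∈

  cross : (Bool → Bool) → Fin n × Fin n → Subset n → Subset n
  cross a e S = extend (a (reversal S e)) (target (reversal S e) e) S

  cross-cong : ∀ a a' e S → a (reversal S e) ≡ a' (reversal S e) → cross a e S ≡ cross a' e S
  cross-cong a a' e S eq = cong (λ b → extend b (target (reversal S e) e) S) eq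

  cross-⊇ : ∀ a e {S} → S ⊆ cross a e S
  cross-⊇ a e {S} = extend-⊇ (a (reversal S e)) (target (reversal S e) e)

  cross-lands : ∀ a e {S x y} → Touches S e → Carries e a x y → y ∈ cross a e S
  cross-lands a (u , v) {S} t c with u ∈? S | t | c
  ... | yes _   | _       | inj₁ (refl , p) = extend-hit v S p
  ... | yes u∈S | _       | inj₂ (refl , _) = extend-⊇ (a false) v u∈S
  ... | no u∉S  | inj₁ u∈S | _              = ⊥-elim (u∉S u∈S)
  ... | no _    | inj₂ v∈S | inj₁ (refl , _) = extend-⊇ (a true) u v∈S
  ... | no _    | inj₂ _  | inj₂ (refl , p) = extend-hit u S p

  cross-sound : ∀ a e {S y} → Touches S e → y ∈ cross a e S →
                y ∈ S ⊎ ∃ λ x → x ∈ S × Carries e a x y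
  cross-sound a (u , v) {S} t y∈ with u ∈? S | t
  ... | yes u∈S | _ = Sum.map₂ (λ { (p , refl) → u , u∈S , inj₁ (refl , p) }) (extend-inv (a false) v S y∈)
  ... | no u∉S  | inj₁ u∈S = ⊥-elim (u∉S u∈S)
  ... | no _    | inj₂ v∈S = Sum.map₂ (λ { (p , refl) → v , v∈S , inj₂ (refl , p) }) (extend-inv (a true) u S y∈)

module Search {n m : ℕ} (E : Fin m → Fin n × Fin n) where

  Permission : Set
  Permission = Fin m → Bool → Bool

  Step : Permission → Fin n → Fin n → Set
  Step π x y = ∃ λ i → Carries (E i) (π i) x y

  StepIn : Permission → List (Fin m) → Fin n → Fin n → Set
  StepIn π P x y = ∃ λ i → i ∈ₗ P × Carries (E i) (π i) x y

  data Frontier (S : Subset n) (P : List (Fin m)) : Set where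
    exhausted : (∀ {i} → i ∈ₗ P → ¬ Touches S (E i)) → Frontier S P
    edgeAt    : ∀ i → i ∈ₗ P → Touches S (E i) → Frontier S P

  frontier : ∀ S P → Frontier S P
  frontier S P with any? (λ i → touches? S (E i)) P
  ... | yes p = let (i , i∈P , t) = find p in edgeAt i i∈P t
  ... | no ¬p = exhausted (λ i∈P t → ¬p (lose i∈P t))

  differs? : (i : Fin m) → Decidable (λ j → ¬ j ≡ i)
  differs? i j = ¬? (j ≟ i)

  remove : Fin m → List (Fin m) → List (Fin m)
  remove i = filter (differs? i)

  remove-⊆ : ∀ {i j} P → j ∈ₗ remove i P → j ∈ₗ P
  remove-⊆ {i} P j∈ = proj₁ (∈-filter⁻ (differs? i) {xs = P} j∈)

  remove-keeps : ∀ {i j} P → j ∈ₗ P → ¬ j ≡ i → j ∈ₗ remove i P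
  remove-keeps {i} P = ∈-filter⁺ (differs? i)

  removed : ∀ {i} P → ¬ i ∈ₗ remove i P
  removed {i} P i∈ = proj₂ (∈-filter⁻ (differs? i) {xs = P} i∈) refl

  -- this is why length P is enough fuel for the search
  remove-shorter : ∀ {i} P → i ∈ₗ P → suc (length (remove i P)) ≤ length P
  remove-shorter {i} P i∈P = filter-notAll (differs? i) P (Any.map (λ i≡j j≢i → j≢i (sym i≡j)) i∈P)

  explore : Permission → ℕ → List (Fin m) → Subset n → Vec Bool m → Subset n × Vec Bool m
  explore π zero P S r = S , r
  explore π (suc k) P S r with frontier S P
  ... | exhausted _ = S , r
  ... | edgeAt i _ _ = explore π k (remove i P) (cross (π i) (E i) S) (r [ i ]≔ reversal S (E i))

  explored : Permission → ℕ → List (Fin m) → Subset n → Vec Bool m → Subset n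
  explored π k P S r = proj₁ (explore π k P S r)

  reversals : Permission → ℕ → List (Fin m) → Subset n → Vec Bool m → Vec Bool m
  reversals π k P S r = proj₂ (explore π k P S r)

  reversals-frame : ∀ π k P S r {j} → ¬ j ∈ₗ P → lookup (reversals π k P S r) j ≡ lookup r j
  reversals-frame π zero P S r j∉P = refl
  reversals-frame π (suc k) P S r {j} j∉P with frontier S P
  ... | exhausted _ = refl
  ... | edgeAt i i∈P _ = trans (reversals-frame π k _ _ _ (j∉P ∘ remove-⊆ P))
                               (lookup∘update′ (λ { refl → j∉P i∈P }) r _)

  reversal-recorded : ∀ π k P S r i →
                      lookup (reversals π k (remove i P) (cross (π i) (E i) S) (r [ i ]≔ reversal S (E i))) i
                        ≡ reversal S (E i)
  reversal-recorded π k P S r i = trans (reversals-frame π k _ _ _ (removed P)) (lookup∘update i r _)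

  explore-agree : ∀ π π' k P S r →
                  (∀ {i} → i ∈ₗ P → π' i (lookup (reversals π k P S r) i) ≡ π i (lookup (reversals π k P S r) i)) →
                  explore π' k P S r ≡ explore π k P S r
  explore-agree π π' zero P S r agree = refl
  explore-agree π π' (suc k) P S r agree with frontier S P
  ... | exhausted _ = refl
  ... | edgeAt i i∈P _ = begin
      explore π' k P' (cross (π' i) (E i) S) r'  ≡⟨ cong (λ S' → explore π' k P' S' r') (cross-cong (π' i) (π i) (E i) S same-at-i) ⟩
      explore π' k P' (cross (π i) (E i) S) r'   ≡⟨ explore-agree π π' k P' _ r' (agree ∘ remove-⊆ P) ⟩
      explore π k P' (cross (π i) (E i) S) r'    ∎
    where
    open ≡-Reasoning
    P' : List (Fin m)
    P' = remove i P
    r' : Vec Bool m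
    r' = r [ i ]≔ reversal S (E i)
    same-at-i : π' i (reversal S (E i)) ≡ π i (reversal S (E i))
    same-at-i = subst (λ b → π' i b ≡ π i b) (reversal-recorded π k P S r i) (agree i∈P)

  module _ (π : Permission) where

    explore-⊇ : ∀ k P S r → S ⊆ explored π k P S r
    explore-⊇ zero P S r x∈S = x∈S
    explore-⊇ (suc k) P S r x∈S with frontier S P
    ... | exhausted _ = x∈S
    ... | edgeAt i _ _ = explore-⊇ k _ _ _ (cross-⊇ (π i) (E i) x∈S)

    explore-closed : ∀ k P S r → length P ≤ k → ∀ {x y} →
                     x ∈ explored π k P S r → StepIn π P x y → y ∈ explored π k P S r
    explore-closed zero [] S r _ _ (_ , () , _)
    explore-closed (suc k) P S r len {x} x∈ (j , j∈P , c) with frontier S P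
    ... | exhausted none = ⊥-elim (none j∈P (carries-touches (E j) (π j) x∈ c))
    ... | edgeAt i i∈P t with j ≟ i
    ...   | yes refl = explore-⊇ k _ _ _ (cross-lands (π i) (E i) t c)
    ...   | no j≢i = explore-closed k (remove i P) _ _ (≤-pred (≤-trans (remove-shorter P i∈P) len)) x∈
                       (j , remove-keeps P j∈P j≢i , c)

    widen : ∀ {P P'} → (∀ {j} → j ∈ₗ P' → j ∈ₗ P) → ∀ {x y} → Star (StepIn π P') x y → Star (StepIn π P) x y
    widen P'⊆P = Star.map (λ { (j , j∈P' , c) → j , P'⊆P j∈P' , c })

    explore-sound : ∀ k P S r {y} → y ∈ explored π k P S r → ∃ λ x → x ∈ S × Star (StepIn π P) x y
    explore-sound zero P S r {y} y∈ = y , y∈ , ε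
    explore-sound (suc k) P S r {y} y∈ with frontier S P
    ... | exhausted _ = y , y∈ , ε
    ... | edgeAt i i∈P t with explore-sound k (remove i P) _ _ y∈
    ...   | z , z∈ , path with cross-sound (π i) (E i) t z∈
    ...     | inj₁ z∈S = z , z∈S , widen (remove-⊆ P) path
    ...     | inj₂ (x , x∈S , c) = x , x∈S , (i , i∈P , c) ◅ widen (remove-⊆ P) path

    reach : ∀ s r y → y ∈ explored π m (allFin m) ⁅ s ⁆ r ⇔ Star (Step π) s y
    reach s r y = mk⇔ to from
      where
      enough : length (allFin m) ≤ m
      enough = ≤-reflexive (length-tabulate (λ i → i))
      closed : ∀ {x y} → x ∈ explored π m (allFin m) ⁅ s ⁆ r → Star (Step π) x y → y ∈ explored π m (allFin m) ⁅ s ⁆ r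
      closed x∈ ε = x∈
      closed x∈ ((i , c) ◅ path) = closed (explore-closed m (allFin m) _ r enough x∈ (i , ∈-allFin i , c)) path
      to : y ∈ explored π m (allFin m) ⁅ s ⁆ r → Star (Step π) s y
      to y∈ with explore-sound m (allFin m) ⁅ s ⁆ r y∈
      ... | x , x∈s , path rewrite x∈⁅y⁆⇒x≡y s x∈s = Star.map (λ { (i , _ , c) → i , c }) path
      from : Star (Step π) s y → y ∈ explored π m (allFin m) ⁅ s ⁆ r
      from = closed (explore-⊇ m (allFin m) ⁅ s ⁆ r (x∈⁅x⁆ s))

  -- The two kinds of objects on the edges: an orientation o permits crossing
  -- edge i only along its direction, an edge set X permits crossing edge i
  -- both ways if i ∈ X and not at all otherwise.
  data Kind : Set where
    orientation edgeSet : Kind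

  dual : Kind → Kind
  dual orientation = edgeSet
  dual edgeSet = orientation

  permission : Kind → Vec Bool m → Permission
  permission orientation o i reversed = reversed xor lookup o i
  permission edgeSet X i reversed = lookup X i

  permission-toggle : ∀ κ ρ b i → permission (dual κ) (zipWith _xor_ ρ b) i (lookup ρ i) ≡ permission κ b i (lookup ρ i)
  permission-toggle orientation ρ b i = lookup-zipWith _xor_ i ρ b
  permission-toggle edgeSet ρ b i = trans (cong (lookup ρ i xor_) (lookup-zipWith _xor_ i ρ b)) (xor-cancel (lookup ρ i) (lookup b i))

  module _ (s : Fin n) where

    run : Kind → Vec Bool m → Subset n × Vec Bool m
    run κ b = explore (permission κ b) m (allFin m) ⁅ s ⁆ (replicate m false)

    transfer : Kind → Vec Bool m → Vec Bool m
    transfer κ b = zipWith _xor_ (proj₂ (run κ b)) b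

    run-transfer : ∀ κ b → run (dual κ) (transfer κ b) ≡ run κ b
    run-transfer κ b = explore-agree (permission κ b) (permission (dual κ) (transfer κ b)) m (allFin m) ⁅ s ⁆ _
                         (λ {i} _ → permission-toggle κ (proj₂ (run κ b)) b i)

    transfer-involutive : ∀ κ b → transfer (dual κ) (transfer κ b) ≡ b
    transfer-involutive κ b =
      trans (cong (λ ρ → zipWith _xor_ ρ (transfer κ b)) (cong proj₂ (run-transfer κ b)))
            (toggle-twice (proj₂ (run κ b)) b)

module _ {n} (G : SimpleGraph n) (s : Fin n) where
  open Search (edge G)

  arc⇔step : ∀ (o : Orientation G) {x y} → Arc G o x y ⇔ Step (permission orientation o) x y
  arc⇔step o = mk⇔ to from
    where
    to : ∀ {x y} → Arc G o x y → Step (permission orientation o) x y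
    to (i , inj₁ forward) = i , inj₁ forward
    to (i , inj₂ (e , o-false)) = i , inj₂ (e , cong not o-false)
    from : ∀ {x y} → Step (permission orientation o) x y → Arc G o x y
    from (i , inj₁ forward) = i , inj₁ forward
    from (i , inj₂ (e , not-o-true)) = i , inj₂ (e , not-injective {y = false} not-o-true)

  adj⇔step : ∀ (X : EdgeSubset G) {x y} → Adj G X x y ⇔ Step (permission edgeSet X) x y
  adj⇔step X = mk⇔ to from
    where
    to : ∀ {x y} → Adj G X x y → Step (permission edgeSet X) x y
    to (i , i∈X , inj₁ e) = i , inj₁ (e , i∈X)
    to (i , i∈X , inj₂ e) = i , inj₂ (e , i∈X)
    from : ∀ {x y} → Step (permission edgeSet X) x y → Adj G X x y
    from (i , inj₁ (e , i∈X)) = i , i∈X , inj₁ e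
    from (i , inj₂ (e , i∈X)) = i , i∈X , inj₂ e

  reachable⇔explored : ∀ o w → Reachable G o s w ⇔ w ∈ proj₁ (run s orientation o)
  reachable⇔explored o w = ⇔.trans (star⇔ (arc⇔step o)) (⇔.sym (reach (permission orientation o) s _ w))

  connected⇔explored : ∀ X w → Connected G X s w ⇔ w ∈ proj₁ (run s edgeSet X)
  connected⇔explored X w = ⇔.trans (star⇔ (adj⇔step X)) (⇔.sym (reach (permission edgeSet X) s _ w))

  reaches? : ∀ W → Decidable (AllReachable G s W)
  reaches? W o = Dec.map (⇔.sym (covers⇔ (reachable⇔explored o))) (W ⊆? proj₁ (run s orientation o))

  reaches⇔connects : ∀ W o → AllReachable G s W o ⇔ SameComponent G s W (transfer s orientation o)
  reaches⇔connects W o = ⇔.trans (covers⇔ (reachable⇔explored o))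
    (subst (λ r → W ⊆ proj₁ r ⇔ SameComponent G s W (transfer s orientation o))
           (run-transfer s orientation o)
           (⇔.sym (covers⇔ (connected⇔explored (transfer s orientation o)))))

theorem4p13 : ∀ {n} (G : SimpleGraph n) (s : Fin n) (W : Subset n) →
    Σ ℕ λ k → HasCount (AllReachable G s W) k × HasCount (SameComponent G s W) k
theorem4p13 G s W = k , reaching , connecting
  where
  open Search (edge G)
  orientations : Enumeration (Orientation G)
  orientations = vectors booleans (#E G)
  k : ℕ
  k = length (filter (reaches? G s W) (elements orientations))
  reaching : HasCount (AllReachable G s W) k
  reaching = count orientations (reaches? G s W)
  connecting : HasCount (SameComponent G s W) k
  connecting = count-transfer (transfer s orientation) (transfer s edgeSet)
                 (transfer-involutive s orientation) (transfer-involutive s edgeSet)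
                 (reaches⇔connects G s W) reaching
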